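{- Let $(\mathbf{A},r,k)$ be a yes-instance of \textsc{Binary $r$-Means}, where $\mathbf{A}$ is a binary $m\times n$ matrix. Then there is a solution $\{I_1,\ldots,I_{r'}\}$ with $r'\le r$ that is regular, i.e., for every initial cluster $I$ of $\mathbf{A}$ there is $i\in\{1,\ldots,r'\}$ with $I\subseteq I_i$.
   Context: For binary vectors, $d_H$ denotes Hamming distance. \textsc{Binary $r$-Means}: the input is a binary $m\times n$ matrix $\mathbf{A}$ with columns $\mathbf{a}^1,\ldots,\mathbf{a}^n$, a positive integer $r$ and a nonnegative integer $k$; decide whether there exist a positive integer $r'\le r$, a partition $\{I_1,\ldots,I_{r'}\}$ of $\{1,\ldots,n\}$ and vectors $\mathbf{c}^1,\ldots,\mathbf{c}^{r'}\in\{0,1\}^m$ with $\sum_{i=1}^{r'}\sum_{j\in I_i} d_H(\mathbf{c}^i,\mathbf{a}^j)\le k$. Such a partition (for which suitable vectors $\mathbf{c}^i$ exist) is called a solution. An initial cluster of $\mathbf{A}$ is an inclusion-maximal set $I\subseteq\{1,\ldots,n\}$ such that all columns $\mathbf{a}^j$, $j\in I$, are equal. A partition $\{I_1,\ldots,I_{r'}\}$ of $\{1,\ldots,n\}$ is regular if every initial cluster is contained in some $I_i$. -}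

module Defs where

open import Data.Bool using (Bool; true; false)
open import Data.Nat using (ℕ; zero; suc; _+_; _≤_)
open import Data.Fin using (Fin; zero; suc)
open import Data.Fin.Subset using (Subset; _∈_; _⊆_)
open import Data.Product using (Σ; ∃; ∃-syntax; _×_; _,_)
open import Function.Definitions using (Surjective)
open import Relation.Binary.PropositionalEquality using (_≡_)
open import Relation.Nullary using (Dec; yes; no; ¬_)
open import Data.Bool.Properties using (_≟_)

Matrix : ℕ → ℕ → Set
Matrix m n = Fin m → Fin n → Bool

col : ∀ {m n} → Matrix m n → Fin n → (Fin m → Bool)
col A j i = A i j

sumFin : ∀ n → (Fin n → ℕ) → ℕ
sumFin zero    f = 0
sumFin (suc n) f = f zero + sumFin n (λ i → f (suc i))

dH : ∀ {m} → (Fin m → Bool) → (Fin m → Bool) → ℕ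
dH {m} x y = sumFin m (λ i → diff (x i ≟ y i))
  where
  diff : ∀ {a b : Bool} → Dec (a ≡ b) → ℕ
  diff (yes _) = 0
  diff (no _)  = 1

-- A partition {I_1,…,I_r'} of {1,…,n} into r' (nonempty) blocks, encoded as
-- a surjective block assignment  f : Fin n → Fin r'  (I_i = f⁻¹(i)).
IsPartition : ∀ {n r'} → (Fin n → Fin r') → Set
IsPartition f = Surjective _≡_ _≡_ f

-- cost  Σ_i Σ_{j ∈ I_i} d_H(c^i, a^j)  =  Σ_j d_H(c^{f(j)}, a^j)
cost : ∀ {m n r'} → Matrix m n → (Fin n → Fin r') → (Fin r' → (Fin m → Bool)) → ℕ
cost {n = n} A f c = sumFin n (λ j → dH (c (f j)) (col A j))

IsSolution : ∀ {m n} → Matrix m n → ℕ → ℕ → (r' : ℕ) → (Fin n → Fin r') → Set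
IsSolution {m} A r k r' f =
  1 ≤ r' × r' ≤ r × IsPartition f ×
  ∃[ c ] (cost A f c ≤ k)

YesInstance : ∀ {m n} → Matrix m n → ℕ → ℕ → Set
YesInstance {n = n} A r k = ∃[ r' ] Σ (Fin n → Fin r') (λ f → IsSolution A r k r' f)

AllEqualCols : ∀ {m n} → Matrix m n → Subset n → Set
AllEqualCols A I = ∀ j j' → j ∈ I → j' ∈ I → ∀ i → A i j ≡ A i j'

InitialCluster : ∀ {m n} → Matrix m n → Subset n → Set
InitialCluster {n = n} A I =
  AllEqualCols A I × (∀ (J : Subset n) → I ⊆ J → AllEqualCols A J → J ⊆ I)

IsRegular : ∀ {m n r'} → Matrix m n → (Fin n → Fin r') → Set
IsRegular {n = n} {r'} A f =
  ∀ (I : Subset n) → InitialCluster A I → ∃[ i ] (∀ j → j ∈ I → f j ≡ i)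

-- Reassigning every column to a nearest centre never increases the cost, and the
-- nearest centre depends only on the column itself, so equal columns land in the
-- same block. Restricting the codomain to the blocks actually used makes the
-- assignment a partition again, with no more blocks than before.
module Submission where

open import Defs
open import Data.Nat using (ℕ)
open import Data.Fin using (Fin)
open import Data.Product using (Σ; ∃-syntax; _×_)

open import Data.Bool using (Bool)
open import Data.Nat.Base using (zero; suc; _+_; _≤_; z≤n; s≤s; >-nonZero⁻¹)
open import Data.Nat.Properties
  using (_≤?_; ≤-refl; ≤-trans; +-mono-≤; ≰⇒>; <⇒≤; n≤1+n; module ≤-Reasoning)
open import Data.Fin.Base using (zero; suc; punchIn; punchOut)
open import Data.Fin.Properties
  using (_≟_; any?; all?; ¬∀⟶∃¬; nonZeroIndex; punchIn-punchOut; punchIn-injective)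
open import Data.Fin.Subset.Properties using (_∈?_)
open import Data.Product using (∃; _,_; proj₁; proj₂)
open import Data.Empty using (⊥-elim)
open import Function.Base using (_∘_)
open import Function.Definitions using (Injective; StrictlySurjective)
open import Function.Consequences.Propositional using (strictlySurjective⇒surjective)
open import Relation.Nullary using (Dec; yes; no; ¬_)
open import Relation.Binary.PropositionalEquality
  using (_≡_; _≢_; _≗_; refl; sym; trans; cong; cong₂)

sumFin-cong : ∀ n {f g : Fin n → ℕ} → f ≗ g → sumFin n f ≡ sumFin n g
sumFin-cong zero    f≗g = refl
sumFin-cong (suc n) f≗g = cong₂ _+_ (f≗g zero) (sumFin-cong n (f≗g ∘ suc))

sumFin-mono-≤ : ∀ n {f g : Fin n → ℕ} → (∀ i → f i ≤ g i) → sumFin n f ≤ sumFin n g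
sumFin-mono-≤ zero    f≤g = z≤n
sumFin-mono-≤ (suc n) f≤g = +-mono-≤ (f≤g zero) (sumFin-mono-≤ n (f≤g ∘ suc))

dH-congʳ : ∀ {m} (x : Fin m → Bool) {y y′ : Fin m → Bool} → y ≗ y′ → dH x y ≡ dH x y′
dH-congʳ {zero}  x y≗y′ = refl
dH-congʳ {suc m} x y≗y′ rewrite y≗y′ zero = cong₂ _+_ refl (dH-congʳ (x ∘ suc) (y≗y′ ∘ suc))

choose : ∀ {a b} {A : Set a} {P : Set b} → Dec P → A → A → A
choose (yes _) x y = x
choose (no _)  x y = y

argmin : ∀ {r} → (Fin (suc r) → ℕ) → Fin (suc r)
argmin {zero}  d = zero
argmin {suc r} d = choose (d zero ≤? d (suc i)) zero (suc i)
  where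
  i : Fin (suc r)
  i = argmin (d ∘ suc)

argmin-minimal : ∀ {r} (d : Fin (suc r) → ℕ) i → d (argmin d) ≤ d i
argmin-minimal {zero} d zero = ≤-refl
argmin-minimal {suc r} d i with d zero ≤? d (suc (argmin (d ∘ suc))) | i
... | yes d₀≤ | zero  = ≤-refl
... | yes d₀≤ | suc i = ≤-trans d₀≤ (argmin-minimal (d ∘ suc) i)
... | no  d₀≰ | zero  = <⇒≤ (≰⇒> d₀≰)
... | no  d₀≰ | suc i = argmin-minimal (d ∘ suc) i

argmin-cong : ∀ {r} {d d′ : Fin (suc r) → ℕ} → d ≗ d′ → argmin d ≡ argmin d′
argmin-cong {zero}  d≗d′ = refl
argmin-cong {suc r} {d} {d′} d≗d′
  rewrite argmin-cong {d = d ∘ suc} {d′ ∘ suc} (d≗d′ ∘ suc)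
        | d≗d′ zero | d≗d′ (suc (argmin (d′ ∘ suc))) = refl

record ImageFactorisation {n r : ℕ} (g : Fin n → Fin r) : Set where
  field
    size            : ℕ
    size≤           : size ≤ r
    onto            : Fin n → Fin size
    embed           : Fin size → Fin r
    onto-surjective : StrictlySurjective _≡_ onto
    embed-injective : Injective _≡_ _≡_ embed
    factorises      : ∀ j → embed (onto j) ≡ g j

surjectiveFactorisation : ∀ {n r} {g : Fin n → Fin r} →
  StrictlySurjective _≡_ g → ImageFactorisation g
surjectiveFactorisation {r = r} {g} g-onto = record
  { size = r ; size≤ = ≤-refl ; onto = g ; embed = λ i → i
  ; onto-surjective = g-onto ; embed-injective = λ e → e ; factorises = λ _ → refl }

postcompose : ∀ {n r s} {g₁ : Fin n → Fin r} {g : Fin n → Fin s} (e : Fin r → Fin s) →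
  r ≤ s → Injective _≡_ _≡_ e → (∀ j → e (g₁ j) ≡ g j) →
  ImageFactorisation g₁ → ImageFactorisation g
postcompose e r≤s e-injective e∘g₁≗g F = record
  { size = size ; size≤ = ≤-trans size≤ r≤s ; onto = onto ; embed = e ∘ embed
  ; onto-surjective = onto-surjective
  ; embed-injective = embed-injective ∘ e-injective
  ; factorises = λ j → trans (cong e (factorises j)) (e∘g₁≗g j) }
  where open ImageFactorisation F

imageFactorisation : ∀ {n r} (g : Fin n → Fin r) → ImageFactorisation g
imageFactorisation {r = zero} g = surjectiveFactorisation (λ ())
imageFactorisation {r = suc r} g with all? (λ y → any? (λ x → g x ≟ y))
... | yes g-onto = surjectiveFactorisation g-onto
... | no ¬g-onto =
  postcompose (punchIn v) (n≤1+n r) (punchIn-injective v _ _)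
    (λ j → punchIn-punchOut (v∉g j)) (imageFactorisation (λ j → punchOut (v∉g j)))
  where
  missed : ∃ λ v → ¬ ∃ λ j → g j ≡ v
  missed = ¬∀⟶∃¬ (suc r) _ (λ y → any? (λ x → g x ≟ y)) ¬g-onto
  v : Fin (suc r)
  v = proj₁ missed
  v∉g : ∀ j → v ≢ g j
  v∉g j v≡gj = proj₂ missed (j , sym v≡gj)

RespectsColumns : ∀ {m n r} → Matrix m n → (Fin n → Fin r) → Set
RespectsColumns A f = ∀ j j′ → col A j ≗ col A j′ → f j ≡ f j′

respects⇒regular : ∀ {m n r} (A : Matrix m n) {f : Fin n → Fin r} →
  Fin r → RespectsColumns A f → IsRegular A f
respects⇒regular A {f} i₀ f-respects I (I-equal , _) with any? (_∈? I)
... | yes (j₀ , j₀∈I) = f j₀ , λ j j∈I → f-respects j j₀ (I-equal j j₀ j∈I j₀∈I)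
... | no  I-empty     = i₀ , λ j j∈I → ⊥-elim (I-empty (j , j∈I))

onto-respects : ∀ {m n r} (A : Matrix m n) {g : Fin n → Fin r} (F : ImageFactorisation g) →
  RespectsColumns A g → RespectsColumns A (ImageFactorisation.onto F)
onto-respects A F g-respects j j′ j≗j′ =
  embed-injective (trans (factorises j) (trans (g-respects j j′ j≗j′) (sym (factorises j′))))
  where open ImageFactorisation F

cost-factorise : ∀ {m n r} (A : Matrix m n) {g : Fin n → Fin r} (F : ImageFactorisation g)
  (c : Fin r → (Fin m → Bool)) →
  cost A (ImageFactorisation.onto F) (c ∘ ImageFactorisation.embed F) ≡ cost A g c
cost-factorise {n = n} A F c = sumFin-cong n (λ j → cong (λ i → dH (c i) (col A j)) (factorises j))
  where open ImageFactorisation F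

nearest : ∀ {m r} → (Fin (suc r) → (Fin m → Bool)) → (Fin m → Bool) → Fin (suc r)
nearest c v = argmin (λ i → dH (c i) v)

nearest-respects : ∀ {m n r} (A : Matrix m n) (c : Fin (suc r) → (Fin m → Bool)) →
  RespectsColumns A (nearest c ∘ col A)
nearest-respects A c j j′ j≗j′ = argmin-cong (λ i → dH-congʳ (c i) j≗j′)

cost-nearest≤ : ∀ {m n r} (A : Matrix m n) (f : Fin n → Fin (suc r))
  (c : Fin (suc r) → (Fin m → Bool)) → cost A (nearest c ∘ col A) c ≤ cost A f c
cost-nearest≤ {n = n} A f c =
  sumFin-mono-≤ n (λ j → argmin-minimal (λ i → dH (c i) (col A j)) (f j))

lemma1 : ∀ {m n} (A : Matrix m n) (r k : ℕ) → YesInstance A r k →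
    ∃[ r' ] Σ (Fin n → Fin r') (λ f → IsSolution A r k r' f × IsRegular A f)
lemma1 {n = n} A r k (suc r₀ , f , (s≤s z≤n , r′≤r , f-onto , c , cost≤k)) =
  size , onto ,
  ( >-nonZero⁻¹ size ⦃ nonZeroIndex (onto j₀) ⦄ , ≤-trans size≤ r′≤r
  , strictlySurjective⇒surjective onto-surjective , c ∘ embed , cost≤k′ ) ,
  respects⇒regular A (onto j₀) (onto-respects A F (nearest-respects A c))
  where
  F : ImageFactorisation (nearest c ∘ col A)
  F = imageFactorisation (nearest c ∘ col A)
  open ImageFactorisation F
  j₀ : Fin n
  j₀ = proj₁ (f-onto zero)
  open ≤-Reasoning
  cost≤k′ : cost A onto (c ∘ embed) ≤ k
  cost≤k′ = begin
    cost A onto (c ∘ embed)      ≡⟨ cost-factorise A F c ⟩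
    cost A (nearest c ∘ col A) c ≤⟨ cost-nearest≤ A f c ⟩
    cost A f c                   ≤⟨ cost≤k ⟩
    k                            ∎
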